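{- Let $G$ be a connected graph on $5$ vertices. Then $\mathcal{H}_3(G)$ is Mengerian if and only if $G$ is a path with double stars or a star plus an edge between two of its leaves.
   Context: All graphs are finite, simple and undirected. For a graph $G$, $\mathcal{H}_3(G)$ is the $4$-uniform hypergraph on $V(G)$ whose hyperedges are the $4$-element subsets of $V(G)$ that contain a path of length $3$ in $G$ (the vertices can be ordered $v_1,\dots,v_4$ with $\{v_i,v_{i+1}\}\in E(G)$ for $i=1,2,3$). A tree $T$ is a path with double stars if at most two vertices of $T$ are adjacent to leaves (this includes stars and paths). A star plus an edge between two of its leaves is $K_{1,n}$ with one additional edge joining two of its leaves. A clutter with incidence matrix $A$ on $n$ vertices is Mengerian if for every $c\in\mathbb{Z}_{\ge0}^n$, $\min\{\langle c,x\rangle: x\ge0 \text{ integral}, Ax\ge\mathbf 1\}=\max\{\langle y,\mathbf 1\rangle : y\ge 0\text{ integral}, y^\top A\le c^\top\}$; the empty clutter is Mengerian. -}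

module Defs where

open import Data.Nat using (ℕ; zero; suc; _+_; _*_; _≤_)
open import Data.Bool using (Bool; true; false; if_then_else_)
open import Data.Fin using (Fin; zero; suc)
open import Data.Fin.Subset using (Subset; _∈_; ∣_∣; inside; outside)
open import Data.Vec using ([]; _∷_; lookup)
open import Data.Product using (Σ; ∃; ∃-syntax; _×_; _,_)
open import Data.Sum using (_⊎_)
open import Relation.Nullary using (¬_)
open import Relation.Binary.PropositionalEquality using (_≡_; _≢_)
open import Function.Bundles using (_⇔_)

∑ : {n : ℕ} → (Fin n → ℕ) → ℕ
∑ {zero}  f = 0
∑ {suc n} f = f zero + ∑ (λ i → f (suc i))

∑Sub : {n : ℕ} → (Subset n → ℕ) → ℕ
∑Sub {zero}  f = f []
∑Sub {suc n} f = ∑Sub (λ s → f (outside ∷ s)) + ∑Sub (λ s → f (inside ∷ s))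

record Graph (n : ℕ) : Set where
  field
    adj    : Fin n → Fin n → Bool
    sym    : ∀ u v → adj u v ≡ adj v u
    irrefl : ∀ v → adj v v ≡ false
open Graph public

Adj : {n : ℕ} → Graph n → Fin n → Fin n → Set
Adj G u v = adj G u v ≡ true

data Walk {n : ℕ} (G : Graph n) : Fin n → Fin n → Set where
  here : ∀ {u} → Walk G u u
  step : ∀ {u w v} → Adj G u w → Walk G w v → Walk G u v

Connected : {n : ℕ} → Graph n → Set
Connected G = ∀ u v → Walk G u v

HasCycle : {n : ℕ} → Graph n → Set
HasCycle {n} G =
  Σ ℕ λ k → Σ (Fin (suc (suc (suc k))) → Fin n) λ f →
    (∀ i j → f i ≡ f j → i ≡ j) ×
    (∀ (i : Fin (suc (suc k))) → Adj G (f (Data.Fin.inject₁ i)) (f (suc i))) ×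
    Adj G (f (Data.Fin.fromℕ (suc (suc k)))) (f zero)

Acyclic : {n : ℕ} → Graph n → Set
Acyclic G = ¬ HasCycle G

IsTree : {n : ℕ} → Graph n → Set
IsTree G = Connected G × Acyclic G

degree : {n : ℕ} → Graph n → Fin n → ℕ
degree G v = ∑ (λ u → if adj G v u then 1 else 0)

IsLeaf : {n : ℕ} → Graph n → Fin n → Set
IsLeaf G v = degree G v ≡ 1

-- a tree in which at most two vertices are adjacent to leaves
PathWithDoubleStars : {n : ℕ} → Graph n → Set
PathWithDoubleStars G =
  IsTree G ×
  (∃[ a ] ∃[ b ] ∀ v → (∃[ ℓ ] (IsLeaf G ℓ × Adj G v ℓ)) → (v ≡ a ⊎ v ≡ b))

StarPlusEdge : {n : ℕ} → Graph n → Set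
StarPlusEdge G =
  ∃[ c ] ∃[ x ] ∃[ y ] (x ≢ c × y ≢ c × x ≢ y ×
    (∀ u v → Adj G u v ⇔
       ((u ≡ c × v ≢ c) ⊎ (v ≡ c × u ≢ c) ⊎ (u ≡ x × v ≡ y) ⊎ (u ≡ y × v ≡ x))))

H₃ : {n : ℕ} → Graph n → Subset n → Set
H₃ G S = ∣ S ∣ ≡ 4 ×
  ∃[ v₁ ] ∃[ v₂ ] ∃[ v₃ ] ∃[ v₄ ]
    ((v₁ ∈ S × v₂ ∈ S × v₃ ∈ S × v₄ ∈ S) ×
     (v₁ ≢ v₂ × v₁ ≢ v₃ × v₁ ≢ v₄ × v₂ ≢ v₃ × v₂ ≢ v₄ × v₃ ≢ v₄) ×
     (Adj G v₁ v₂ × Adj G v₂ v₃ × Adj G v₃ v₄))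

-- Mengerian clutters.  A clutter on Fin n is given by its edge predicate
-- E : Subset n → Set; its incidence matrix A has rows indexed by edges.

IsMin : {X : Set} → (X → Set) → (X → ℕ) → ℕ → Set
IsMin {X} P val m = (∃[ x ] (P x × val x ≡ m)) × (∀ x → P x → m ≤ val x)

IsMax : {X : Set} → (X → Set) → (X → ℕ) → ℕ → Set
IsMax {X} P val m = (∃[ x ] (P x × val x ≡ m)) × (∀ x → P x → val x ≤ m)

-- x ≥ 0 integral with A x ≥ 1
IsCover : {n : ℕ} → (Subset n → Set) → (Fin n → ℕ) → Set
IsCover E x = ∀ S → E S → 1 ≤ ∑ (λ v → if lookup S v then x v else 0)

-- y ≥ 0 integral indexed by edges (extended by 0 to non-edges), yᵀA ≤ cᵀ
IsPacking : {n : ℕ} → (Subset n → Set) → (Fin n → ℕ) → (Subset n → ℕ) → Set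
IsPacking E c y =
  (∀ S → ¬ E S → y S ≡ 0) ×
  (∀ v → ∑Sub (λ S → if lookup S v then y S else 0) ≤ c v)

Mengerian : {n : ℕ} → (Subset n → Set) → Set
Mengerian {n} E = ∀ (c : Fin n → ℕ) → ∃[ m ]
  (IsMin (IsCover E) (λ x → ∑ (λ v → c v * x v)) m ×
   IsMax (IsPacking E c) ∑Sub m)

{-# OPTIONS --safe #-}
module Submission where

-- A 4-subset of the five vertices is the complement V ∖ v of a single vertex, and it is an edge
-- of H₃(G) exactly when G − v has a Hamiltonian path; call such v deletable.  A clutter of
-- co-singletons {V ∖ v | v ∈ F} is Mengerian iff |F| ≤ 2.  For |F| ≤ 2 every cost c admits a
-- cover and a packing of equal value: the cheapest vertex outside F, or the two vertices of F if
-- they are cheaper together, against a packing split between the at most two edges.  For three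
-- distinct a, b, d ∈ F take cost 1 on a, b, d and 2 elsewhere: the indicator z of {a, b, d}
-- covers every edge twice at cost 3, and z spread over V ∖ a, V ∖ b, V ∖ d is a packing of value
-- 3 for twice the cost, so weak duality forces 2m = 3 for the common optimum m.  It remains to
-- see that a connected graph on five vertices has at most two deletable vertices iff it is a path
-- with double stars or a star plus an edge; this is checked by evaluating boolean decision
-- procedures, proved correct, on all 2¹⁰ graphs on five vertices.

open import Defs
open import Data.Bool as Bool using (Bool; true; false; not; _∧_; _∨_; _xor_; if_then_else_)
open import Data.Bool.Properties using (T-≡; if-eta)
open import Data.Empty using (⊥; ⊥-elim)
open import Data.Fin using (Fin; zero; suc; toℕ; fromℕ; fromℕ<; inject₁)
open import Data.Fin.Properties using (_≟_; any?; ⊎⇔∃; ∀-cons-⇔; injective⇒≤; toℕ-fromℕ<)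
open import Data.Fin.Subset using (Subset; _∈_; ∣_∣; inside; outside; ∁; ⁅_⁆) renaming (⊥ to ∅)
open import Data.Fin.Subset.Properties using (∣p∣≡n⇒p≡⊤; ∣∁p∣≡n∸∣p∣; ∣⁅x⁆∣≡1)
open import Data.Nat as ℕ using (ℕ; zero; suc; _+_; _*_; _∸_; _≤_; _<_; z≤n; s≤s; _≤?_; _<?_)
open import Data.Nat.Induction using (<-wellFounded)
open import Data.Nat.Properties
  using ( +-comm; +-identityʳ; +-mono-≤; +-commutativeSemigroup; *-comm; *-assoc; *-zeroʳ
        ; *-identityʳ; *-identityˡ; *-distribˡ-+; *-distribʳ-+; *-monoˡ-≤; *-monoʳ-≤
        ; ≤-refl; ≤-trans; ≤-reflexive; ≤-antisym; ≤-total; ≮⇒≥; m+n∸n≡m; ∸-monoʳ-≤; ∸-monoˡ-≤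
        ; suc-injective; module ≤-Reasoning)
open import Algebra.Properties.CommutativeSemigroup +-commutativeSemigroup using (interchange)
open import Data.Product using (∃-syntax; ∃₂; Σ-syntax; _×_; _,_; uncurry)
open import Data.Sum using (_⊎_; inj₁; inj₂; [_,_]′; swap)
open import Data.Sum.Function.Propositional using (_⊎-⇔_)
open import Data.Unit using (⊤; tt)
open import Data.Vec using (Vec; []; _∷_; lookup; tabulate; head)
open import Data.Vec.Properties
  using (≡-dec; lookup-map; lookup-replicate; lookup∘tabulate; []=⇒lookup; lookup⇒[]=; map-replicate)
open import Data.Vec.Relation.Unary.All as All using (All; []; _∷_)
open import Data.Vec.Relation.Unary.AllPairs using ([]; _∷_)
open import Data.Vec.Relation.Unary.Linked using (Linked; []; [-]; _∷_)
open import Data.Vec.Relation.Unary.Unique.Propositional using (Unique)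
open import Data.Vec.Relation.Unary.Unique.Propositional.Properties using (lookup-injective; tabulate⁺)
open import Function using (_∘_; id)
open import Function.Bundles using (_⇔_; mk⇔; Equivalence)
open import Function.Construct.Composition using (_⇔-∘_)
open import Function.Construct.Identity using (⇔-id)
open import Function.Construct.Symmetry using (⇔-sym)
open import Function.Related.Propositional using (module EquationalReasoning)
open import Induction.WellFounded using (Acc; acc)
open import Relation.Binary.Definitions using (DecidableEquality)
open import Relation.Binary.PropositionalEquality as ≡
  using (_≡_; _≢_; refl; cong; cong₂; subst; subst₂)
open import Relation.Nullary
  using (¬_; Dec; yes; no; does; proof; _because_; ¬?; _×-dec_; _⊎-dec_; _→-dec_)
open import Relation.Nullary.Decidable using (dec-true; dec-false; decidable-stable; map′; toWitness)
open import Relation.Nullary.Reflects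
  using (Reflects; ofʸ; ofⁿ; _×-reflects_; _⊎-reflects_; _→-reflects_; ¬-reflects; T-reflects)
open import Relation.Unary using (_⊆_)
import Relation.Unary as U

private variable
  n m : ℕ
  A B : Set
  a b : Bool

∑-cong : {f g : Fin n → ℕ} → (∀ i → f i ≡ g i) → ∑ f ≡ ∑ g
∑-cong {zero}  f≗g = refl
∑-cong {suc n} f≗g = cong₂ _+_ (f≗g zero) (∑-cong (f≗g ∘ suc))

∑-mono : {f g : Fin n → ℕ} → (∀ i → f i ≤ g i) → ∑ f ≤ ∑ g
∑-mono {zero}  f≤g = z≤n
∑-mono {suc n} f≤g = +-mono-≤ (f≤g zero) (∑-mono (f≤g ∘ suc))

∑-zero : ∀ n → ∑ {n} (λ _ → 0) ≡ 0
∑-zero zero    = refl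
∑-zero (suc n) = ∑-zero n

∑-+ : (f g : Fin n → ℕ) → ∑ (λ i → f i + g i) ≡ ∑ f + ∑ g
∑-+ {zero}  f g = refl
∑-+ {suc n} f g = ≡.trans (cong (f zero + g zero +_) (∑-+ (f ∘ suc) (g ∘ suc)))
                          (interchange (f zero) (g zero) (∑ (f ∘ suc)) (∑ (g ∘ suc)))

∑-*ˡ : (k : ℕ) (f : Fin n → ℕ) → ∑ (λ i → k * f i) ≡ k * ∑ f
∑-*ˡ {zero}  k f = ≡.sym (*-zeroʳ k)
∑-*ˡ {suc n} k f = ≡.trans (cong (k * f zero +_) (∑-*ˡ k (f ∘ suc))) (≡.sym (*-distribˡ-+ k (f zero) _))

∑-sift : (u : Fin n) (f : Fin n → ℕ) → ∑ (λ v → if does (v ≟ u) then f v else 0) ≡ f u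
∑-sift {suc n} zero    f = ≡.trans (cong (f zero +_) (∑-zero n)) (+-identityʳ (f zero))
∑-sift {suc n} (suc u) f = ∑-sift u (f ∘ suc)

∑Sub-cong : {f g : Subset n → ℕ} → (∀ S → f S ≡ g S) → ∑Sub f ≡ ∑Sub g
∑Sub-cong {zero}  f≗g = f≗g []
∑Sub-cong {suc n} f≗g = cong₂ _+_ (∑Sub-cong (f≗g ∘ (outside ∷_))) (∑Sub-cong (f≗g ∘ (inside ∷_)))

∑Sub-mono : {f g : Subset n → ℕ} → (∀ S → f S ≤ g S) → ∑Sub f ≤ ∑Sub g
∑Sub-mono {zero}  f≤g = f≤g []
∑Sub-mono {suc n} f≤g = +-mono-≤ (∑Sub-mono (f≤g ∘ (outside ∷_))) (∑Sub-mono (f≤g ∘ (inside ∷_)))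

∑Sub-zero : ∀ n → ∑Sub {n} (λ _ → 0) ≡ 0
∑Sub-zero zero    = refl
∑Sub-zero (suc n) = cong₂ _+_ (∑Sub-zero n) (∑Sub-zero n)

∑Sub-*ʳ : (f : Subset n → ℕ) (k : ℕ) → ∑Sub (λ S → f S * k) ≡ ∑Sub f * k
∑Sub-*ʳ {zero}  f k = refl
∑Sub-*ʳ {suc n} f k =
  ≡.trans (cong₂ _+_ (∑Sub-*ʳ (f ∘ (outside ∷_)) k) (∑Sub-*ʳ (f ∘ (inside ∷_)) k))
          (≡.sym (*-distribʳ-+ k (∑Sub (f ∘ (outside ∷_))) _))

∑Sub-∑-comm : {m : ℕ} (f : Subset m → Fin n → ℕ) → ∑Sub (λ S → ∑ (f S)) ≡ ∑ (λ v → ∑Sub (λ S → f S v))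
∑Sub-∑-comm {m = zero}  f = refl
∑Sub-∑-comm {m = suc m} f =
  ≡.trans (cong₂ _+_ (∑Sub-∑-comm (f ∘ (outside ∷_))) (∑Sub-∑-comm (f ∘ (inside ∷_))))
          (≡.sym (∑-+ (λ v → ∑Sub (λ S → f (outside ∷ S) v)) (λ v → ∑Sub (λ S → f (inside ∷ S) v))))

_≟ₛ_ : DecidableEquality (Subset n)
_≟ₛ_ = ≡-dec Bool._≟_

∑Sub-sift : (T : Subset n) (f : Subset n → ℕ) → ∑Sub (λ S → if does (S ≟ₛ T) then f S else 0) ≡ f T
∑Sub-sift         []            f = refl
∑Sub-sift {suc n} (outside ∷ T) f =
  ≡.trans (cong₂ _+_ (∑Sub-sift T (f ∘ (outside ∷_))) (∑Sub-zero n)) (+-identityʳ _)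
∑Sub-sift {suc n} (inside  ∷ T) f = cong₂ _+_ (∑Sub-zero n) (∑Sub-sift T (f ∘ (inside ∷_)))

-- Covers, packings and weak duality

weight : (Fin n → ℕ) → Subset n → ℕ
weight x S = ∑ λ v → if lookup S v then x v else 0

load : (Subset n → ℕ) → Fin n → ℕ
load y v = ∑Sub λ S → if lookup S v then y S else 0

cost : (Fin n → ℕ) → (Fin n → ℕ) → ℕ
cost c x = ∑ λ v → c v * x v

∑Sub-*weight≡∑-load* : (y : Subset n → ℕ) (x : Fin n → ℕ) →
                       ∑Sub (λ S → y S * weight x S) ≡ ∑ (λ v → load y v * x v)
∑Sub-*weight≡∑-load* y x = begin
  ∑Sub (λ S → y S * weight x S)
    ≡⟨ ∑Sub-cong (λ S → ≡.sym (∑-*ˡ (y S) (λ v → if lookup S v then x v else 0))) ⟩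
  ∑Sub (λ S → ∑ λ v → y S * (if lookup S v then x v else 0))
    ≡⟨ ∑Sub-cong (λ S → ∑-cong λ v → *-if (y S) (x v) (lookup S v)) ⟩
  ∑Sub (λ S → ∑ λ v → (if lookup S v then y S else 0) * x v)
    ≡⟨ ∑Sub-∑-comm (λ S v → (if lookup S v then y S else 0) * x v) ⟩
  ∑ (λ v → ∑Sub λ S → (if lookup S v then y S else 0) * x v)
    ≡⟨ ∑-cong (λ v → ∑Sub-*ʳ (λ S → if lookup S v then y S else 0) (x v)) ⟩
  ∑ (λ v → load y v * x v) ∎
  where
  open ≡.≡-Reasoning
  *-if : ∀ a b c → a * (if c then b else 0) ≡ (if c then a else 0) * b
  *-if a b true  = refl
  *-if a b false = *-zeroʳ a

MinEqualsMax : (Subset n → Set) → (Fin n → ℕ) → ℕ → Set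
MinEqualsMax E c m = IsMin (IsCover E) (cost c) m × IsMax (IsPacking E c) ∑Sub m

module _ {E : Subset n → Set} {c : Fin n → ℕ} where

  weak-duality : {x : Fin n → ℕ} {y : Subset n → ℕ} {k : ℕ} →
                 IsPacking E c y → (∀ S → E S → k ≤ weight x S) → k * ∑Sub y ≤ cost c x
  weak-duality {x} {y} {k} (y-support , y-load) k-cover = begin
    k * ∑Sub y                     ≡⟨ *-comm k (∑Sub y) ⟩
    ∑Sub y * k                     ≡⟨ ∑Sub-*ʳ y k ⟨
    ∑Sub (λ S → y S * k)           ≤⟨ ∑Sub-mono term-bound ⟩
    ∑Sub (λ S → y S * weight x S)  ≡⟨ ∑Sub-*weight≡∑-load* y x ⟩
    ∑ (λ v → load y v * x v)       ≤⟨ ∑-mono (λ v → *-monoˡ-≤ (x v) (y-load v)) ⟩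
    cost c x                       ∎
    where
    open ≤-Reasoning
    term-bound : ∀ S → y S * k ≤ y S * weight x S
    term-bound S with k ≤? weight x S
    ... | yes k≤w = *-monoʳ-≤ (y S) k≤w
    ... | no  k≰w = subst (λ t → t * k ≤ t * weight x S) (≡.sym (y-support S (k≰w ∘ k-cover S))) z≤n

  packing≤cover : {x : Fin n → ℕ} {y : Subset n → ℕ} → IsPacking E c y → IsCover E x → ∑Sub y ≤ cost c x
  packing≤cover {y = y} packing cover = subst (_≤ _) (*-identityˡ (∑Sub y)) (weak-duality packing cover)

  equal-values⇒minEqualsMax : {x : Fin n → ℕ} {y : Subset n → ℕ} →
                              IsCover E x → IsPacking E c y → cost c x ≡ ∑Sub y → ∃[ m ] MinEqualsMax E c m
  equal-values⇒minEqualsMax {x} {y} cover packing x≡y =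
    cost c x ,
    ((x , cover , refl) , λ x′ cover′ → subst (_≤ cost c x′) (≡.sym x≡y) (packing≤cover packing cover′)) ,
    ((y , packing , ≡.sym x≡y) , λ y′ packing′ → packing≤cover packing′ cover)

-- Clutters of co-singletons

does-≟-comm : (u v : Fin n) → does (u ≟ v) ≡ does (v ≟ u)
does-≟-comm u v with v ≟ u
... | yes refl = dec-true (u ≟ u) refl
... | no  v≢u  = dec-false (u ≟ v) (v≢u ∘ ≡.sym)

lookup-∁⁅⁆ : (v w : Fin n) → lookup (∁ ⁅ v ⁆) w ≡ not (does (w ≟ v))
lookup-∁⁅⁆ {suc n} zero    zero    = refl
lookup-∁⁅⁆ {suc n} zero    (suc w) = ≡.trans (lookup-map w not ∅) (cong not (lookup-replicate w outside))
lookup-∁⁅⁆ {suc n} (suc v) zero    = refl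
lookup-∁⁅⁆ {suc n} (suc v) (suc w) = lookup-∁⁅⁆ v w

weight-∁⁅⁆ : (x : Fin n → ℕ) (w : Fin n) → weight x (∁ ⁅ w ⁆) + x w ≡ ∑ x
weight-∁⁅⁆ x w = begin
  weight x (∁ ⁅ w ⁆) + x w
    ≡⟨ cong₂ _+_ (∑-cong λ v → cong (λ b → if b then x v else 0) (lookup-∁⁅⁆ w v)) (≡.sym (∑-sift w x)) ⟩
  ∑ (λ v → if not (does (v ≟ w)) then x v else 0) + ∑ (λ v → if does (v ≟ w) then x v else 0)
    ≡⟨ ∑-+ (λ v → if not (does (v ≟ w)) then x v else 0) (λ v → if does (v ≟ w) then x v else 0) ⟨
  ∑ (λ v → (if not (does (v ≟ w)) then x v else 0) + (if does (v ≟ w) then x v else 0))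
    ≡⟨ ∑-cong (λ v → complementary (does (v ≟ w)) (x v)) ⟩
  ∑ x ∎
  where
  open ≡.≡-Reasoning
  complementary : ∀ b k → (if not b then k else 0) + (if b then k else 0) ≡ k
  complementary true  k = refl
  complementary false k = +-identityʳ k

point : Fin n → ℕ → Fin n → ℕ
point u k v = if does (v ≟ u) then k else 0

point-self : (u : Fin n) (k : ℕ) → point u k u ≡ k
point-self u k = cong (if_then k else 0) (dec-true (u ≟ u) refl)

point-other : {u v : Fin n} (k : ℕ) → v ≢ u → point u k v ≡ 0
point-other {u = u} {v} k v≢u = cong (if_then k else 0) (dec-false (v ≟ u) v≢u)

∑-point : (u : Fin n) (k : ℕ) → ∑ (point u k) ≡ k
∑-point u k = ∑-sift u (λ _ → k)

cost-point : (c : Fin n → ℕ) (u : Fin n) → cost c (point u 1) ≡ c u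
cost-point c u = ≡.trans (∑-cong λ v → *-indicator (c v) (does (v ≟ u))) (∑-sift u c)
  where
  *-indicator : ∀ k b → k * (if b then 1 else 0) ≡ (if b then k else 0)
  *-indicator k true  = *-identityʳ k
  *-indicator k false = *-zeroʳ k

weight-point : (u : Fin n) (k : ℕ) (S : Subset n) → weight (point u k) S ≡ (if lookup S u then k else 0)
weight-point u k S =
  ≡.trans (∑-cong λ v → if-swap (lookup S v) (does (v ≟ u))) (∑-sift u (λ v → if lookup S v then k else 0))
  where
  if-swap : ∀ a b → (if a then (if b then k else 0) else 0) ≡ (if b then (if a then k else 0) else 0)
  if-swap true  b     = refl
  if-swap false true  = refl
  if-swap false false = refl

weight-point-∁⁅⁆ : {u w : Fin n} (k : ℕ) → u ≢ w → weight (point u k) (∁ ⁅ w ⁆) ≡ k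
weight-point-∁⁅⁆ {u = u} {w} k u≢w = ≡.trans (weight-point u k (∁ ⁅ w ⁆))
  (cong (if_then k else 0) (≡.trans (lookup-∁⁅⁆ w u) (cong not (dec-false (u ≟ w) u≢w))))

weight-point-∁⁅⁆-self : (u : Fin n) (k : ℕ) → weight (point u k) (∁ ⁅ u ⁆) ≡ 0
weight-point-∁⁅⁆-self u k = ≡.trans (weight-point u k (∁ ⁅ u ⁆))
  (cong (if_then k else 0) (≡.trans (lookup-∁⁅⁆ u u) (cong not (dec-true (u ≟ u) refl))))

weight-+ : (x x′ : Fin n → ℕ) (S : Subset n) → weight (λ v → x v + x′ v) S ≡ weight x S + weight x′ S
weight-+ x x′ S = ≡.trans (∑-cong λ v → if-+ (lookup S v)) (∑-+ (λ v → if lookup S v then x v else 0) _)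
  where
  if-+ : ∀ {v} b → (if b then x v + x′ v else 0) ≡ (if b then x v else 0) + (if b then x′ v else 0)
  if-+ true  = refl
  if-+ false = refl

cost-+ : (c x x′ : Fin n → ℕ) → cost c (λ v → x v + x′ v) ≡ cost c x + cost c x′
cost-+ c x x′ = ≡.trans (∑-cong λ v → *-distribˡ-+ (c v) (x v) (x′ v)) (∑-+ (λ v → c v * x v) _)

spread : (Fin n → ℕ) → Subset n → ℕ
spread Y S = ∑ λ v → if does (S ≟ₛ ∁ ⁅ v ⁆) then Y v else 0

∑Sub-spread : (Y : Fin n → ℕ) → ∑Sub (spread Y) ≡ ∑ Y
∑Sub-spread Y = ≡.trans (∑Sub-∑-comm (λ S v → if does (S ≟ₛ ∁ ⁅ v ⁆) then Y v else 0))
                        (∑-cong λ v → ∑Sub-sift (∁ ⁅ v ⁆) (λ _ → Y v))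

load-spread : (Y : Fin n → ℕ) (u : Fin n) → load (spread Y) u ≡ weight Y (∁ ⁅ u ⁆)
load-spread {n} Y u = begin
  load (spread Y) u
    ≡⟨ ∑Sub-cong (λ S → if-∑ (lookup S u) S) ⟩
  ∑Sub (λ S → ∑ λ v → if does (S ≟ₛ ∁ ⁅ v ⁆) then (if lookup S u then Y v else 0) else 0)
    ≡⟨ ∑Sub-∑-comm (λ S v → if does (S ≟ₛ ∁ ⁅ v ⁆) then (if lookup S u then Y v else 0) else 0) ⟩
  ∑ (λ v → ∑Sub λ S → if does (S ≟ₛ ∁ ⁅ v ⁆) then (if lookup S u then Y v else 0) else 0)
    ≡⟨ ∑-cong (λ v → ∑Sub-sift (∁ ⁅ v ⁆) (λ S → if lookup S u then Y v else 0)) ⟩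
  ∑ (λ v → if lookup (∁ ⁅ v ⁆) u then Y v else 0)
    ≡⟨ ∑-cong (λ v → cong (if_then Y v else 0) (∁⁅⁆-comm v)) ⟩
  weight Y (∁ ⁅ u ⁆) ∎
  where
  open ≡.≡-Reasoning
  if-∑ : ∀ b S → (if b then spread Y S else 0)
                 ≡ ∑ (λ v → if does (S ≟ₛ ∁ ⁅ v ⁆) then (if b then Y v else 0) else 0)
  if-∑ true  S = refl
  if-∑ false S = ≡.sym (≡.trans (∑-cong λ v → if-eta (does (S ≟ₛ ∁ ⁅ v ⁆))) (∑-zero n))
  ∁⁅⁆-comm : ∀ v → lookup (∁ ⁅ v ⁆) u ≡ lookup (∁ ⁅ u ⁆) v
  ∁⁅⁆-comm v = ≡.trans (lookup-∁⁅⁆ v u) (≡.trans (cong not (does-≟-comm u v)) (≡.sym (lookup-∁⁅⁆ u v)))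

spread-packing : {E : Subset n → Set} {c Y : Fin n → ℕ} → (∀ v → ¬ E (∁ ⁅ v ⁆) → Y v ≡ 0) →
                 (∀ u → weight Y (∁ ⁅ u ⁆) ≤ c u) → IsPacking E c (spread Y)
spread-packing {n} {E} {c} {Y} Y-support Y-load =
  support , λ u → subst (_≤ c u) (≡.sym (load-spread Y u)) (Y-load u)
  where
  support : ∀ S → ¬ E S → spread Y S ≡ 0
  support S ¬ES = ≡.trans (∑-cong term) (∑-zero n)
    where
    term : ∀ v → (if does (S ≟ₛ ∁ ⁅ v ⁆) then Y v else 0) ≡ 0
    term v with S ≟ₛ ∁ ⁅ v ⁆
    ... | yes refl = Y-support v ¬ES
    ... | no  _    = refl

minimiser : {P : Fin n → Set} → U.Decidable P → (f : Fin n → ℕ) →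
            ∀ {u} → P u → ∃[ v ] (P v × ∀ w → P w → f v ≤ f w)
minimiser {n} {P} P? f {u} Pu = go u Pu (<-wellFounded (f u))
  where
  go : ∀ u → P u → Acc _<_ (f u) → ∃[ v ] (P v × ∀ w → P w → f v ≤ f w)
  go u Pu (acc smaller) with any? (λ w → P? w ×-dec f w <? f u)
  ... | yes (w , Pw , fw<fu) = go w Pw (smaller fw<fu)
  ... | no  ∄w               = u , Pu , λ w Pw → ≮⇒≥ (λ fw<fu → ∄w (w , Pw , fw<fu))

split-≤+ : ∀ m s {t} → m ≤ s + t → ∃₂ λ p q → p + q ≡ m × p ≤ s × q ≤ t
split-≤+ zero    s       _           = 0 , 0 , refl , z≤n , z≤n
split-≤+ (suc m) zero    m≤t         = 0 , suc m , refl , z≤n , m≤t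
split-≤+ (suc m) (suc s) (s≤s m≤s+t) with split-≤+ m s m≤s+t
... | p , q , p+q≡m , p≤s , q≤t = suc p , q , cong suc p+q≡m , s≤s p≤s , q≤t

CoSingletonEdges : (Subset n → Set) → Set
CoSingletonEdges E = ∀ S → E S → ∃[ v ] S ≡ ∁ ⁅ v ⁆

module _ {E : Subset n → Set} (edges : CoSingletonEdges E) where

  private
    F : Fin n → Set
    F v = E (∁ ⁅ v ⁆)

    cover-by : {x : Fin n → ℕ} → (∀ v → F v → 1 ≤ weight x (∁ ⁅ v ⁆)) → IsCover E x
    cover-by covers S ES with edges S ES
    ... | v , refl = covers v ES

  mengerian-none : (∀ v → ¬ F v) → Mengerian E
  mengerian-none none c = equal-values⇒minEqualsMax (cover-by λ v Fv → ⊥-elim (none v Fv)) packing value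
    where
    zeros : Fin n → ℕ
    zeros _ = 0
    weight-zeros : ∀ u → weight zeros (∁ ⁅ u ⁆) ≡ 0
    weight-zeros u = ≡.trans (∑-cong λ v → if-eta (lookup (∁ ⁅ u ⁆) v)) (∑-zero n)
    packing : IsPacking E c (spread zeros)
    packing = spread-packing (λ _ _ → refl) (λ u → subst (_≤ c u) (≡.sym (weight-zeros u)) z≤n)
    value : cost c zeros ≡ ∑Sub (spread zeros)
    value = ≡.trans (∑-cong λ v → *-zeroʳ (c v))
                    (≡.trans (∑-zero n) (≡.sym (≡.trans (∑Sub-spread zeros) (∑-zero n))))

  mengerian-one : {a u : Fin n} → (∀ v → F v → v ≡ a) → F a → u ≢ a → Mengerian E
  mengerian-one {a} only Fa u≢a c with minimiser (λ w → ¬? (w ≟ a)) c u≢a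
  ... | m , m≢a , m-min = equal-values⇒minEqualsMax cover packing value
    where
    cover : IsCover E (point m 1)
    cover = cover-by λ v Fv → ≤-reflexive (≡.sym (weight-point-∁⁅⁆ 1 λ m≡v → m≢a (≡.trans m≡v (only v Fv))))
    load-bound : ∀ w → weight (point a (c m)) (∁ ⁅ w ⁆) ≤ c w
    load-bound w with a ≟ w
    ... | yes refl = subst (_≤ c w) (≡.sym (weight-point-∁⁅⁆-self a (c m))) z≤n
    ... | no  a≢w  = subst (_≤ c w) (≡.sym (weight-point-∁⁅⁆ (c m) a≢w)) (m-min w (a≢w ∘ ≡.sym))
    packing : IsPacking E c (spread (point a (c m)))
    packing = spread-packing (λ v ¬Fv → point-other (c m) λ v≡a → ¬Fv (subst F (≡.sym v≡a) Fa)) load-bound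
    value : cost c (point m 1) ≡ ∑Sub (spread (point a (c m)))
    value = ≡.trans (cost-point c m) (≡.sym (≡.trans (∑Sub-spread (point a (c m))) (∑-point a (c m))))

  -- With m a cheapest vertex outside {a, b}, the optimum is c m or c a + c b, whichever is smaller.
  mengerian-two : {a b u : Fin n} → (∀ v → F v → v ≡ a ⊎ v ≡ b) → a ≢ b → F a → F b →
                  u ≢ a → u ≢ b → Mengerian E
  mengerian-two {a} {b} only a≢b Fa Fb u≢a u≢b c
    with minimiser (λ w → ¬? (w ≟ a) ×-dec ¬? (w ≟ b)) c (u≢a , u≢b)
  ... | m , (m≢a , m≢b) , m-min = [ by-single , by-pair ]′ (≤-total (c m) (c a + c b))
    where
    packing-of : ∀ t → t ≤ c a + c b → t ≤ c m → ∃[ y ] (IsPacking E c y × ∑Sub y ≡ t)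
    packing-of t t≤ca+cb t≤cm with split-≤+ t (c b) (subst (t ≤_) (+-comm (c a) (c b)) t≤ca+cb)
    ... | p , q , p+q≡t , p≤cb , q≤ca = spread Y , spread-packing support load-bound , value
      where
      Y : Fin n → ℕ
      Y v = point a p v + point b q v
      support : ∀ v → ¬ F v → Y v ≡ 0
      support v ¬Fv = cong₂ _+_ (point-other p λ v≡a → ¬Fv (subst F (≡.sym v≡a) Fa))
                                (point-other q λ v≡b → ¬Fv (subst F (≡.sym v≡b) Fb))
      bound : ∀ w → weight (point a p) (∁ ⁅ w ⁆) + weight (point b q) (∁ ⁅ w ⁆) ≤ c w
      bound w with a ≟ w | b ≟ w
      ... | yes refl | _        =
        subst (_≤ c a) (≡.sym (cong₂ _+_ (weight-point-∁⁅⁆-self a p) (weight-point-∁⁅⁆ q (a≢b ∘ ≡.sym)))) q≤ca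
      ... | no  a≢w  | yes refl =
        subst (_≤ c b) (≡.sym (cong₂ _+_ (weight-point-∁⁅⁆ p a≢w) (weight-point-∁⁅⁆-self b q)))
              (subst (_≤ c b) (≡.sym (+-identityʳ p)) p≤cb)
      ... | no  a≢w  | no  b≢w  =
        subst (_≤ c w) (≡.sym (cong₂ _+_ (weight-point-∁⁅⁆ p a≢w) (weight-point-∁⁅⁆ q b≢w)))
              (subst (_≤ c w) (≡.sym p+q≡t) (≤-trans t≤cm (m-min w (a≢w ∘ ≡.sym , b≢w ∘ ≡.sym))))
      load-bound : ∀ w → weight Y (∁ ⁅ w ⁆) ≤ c w
      load-bound w = subst (_≤ c w) (≡.sym (weight-+ (point a p) (point b q) (∁ ⁅ w ⁆))) (bound w)
      value : ∑Sub (spread Y) ≡ t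
      value = ≡.trans (∑Sub-spread Y) (≡.trans (∑-+ (point a p) (point b q))
                (≡.trans (cong₂ _+_ (∑-point a p) (∑-point b q)) p+q≡t))
    single-cover : IsCover E (point m 1)
    single-cover = cover-by λ v Fv → ≤-reflexive (≡.sym (weight-point-∁⁅⁆ 1 (m≢ v Fv)))
      where
      m≢ : ∀ v → F v → m ≢ v
      m≢ v Fv m≡v = [ m≢a ∘ ≡.trans m≡v , m≢b ∘ ≡.trans m≡v ]′ (only v Fv)
    pair-cover : IsCover E (λ v → point a 1 v + point b 1 v)
    pair-cover = cover-by λ v Fv →
      subst (1 ≤_) (≡.sym (weight-+ (point a 1) (point b 1) (∁ ⁅ v ⁆))) (covers v (only v Fv))
      where
      covers : ∀ v → v ≡ a ⊎ v ≡ b → 1 ≤ weight (point a 1) (∁ ⁅ v ⁆) + weight (point b 1) (∁ ⁅ v ⁆)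
      covers v (inj₁ refl) =
        ≤-reflexive (≡.sym (cong₂ _+_ (weight-point-∁⁅⁆-self a 1) (weight-point-∁⁅⁆ 1 (a≢b ∘ ≡.sym))))
      covers v (inj₂ refl) =
        ≤-reflexive (≡.sym (cong₂ _+_ (weight-point-∁⁅⁆ 1 a≢b) (weight-point-∁⁅⁆-self b 1)))
    by-single : c m ≤ c a + c b → ∃[ t ] MinEqualsMax E c t
    by-single cm≤ca+cb with packing-of (c m) cm≤ca+cb ≤-refl
    ... | y , packing , value =
      equal-values⇒minEqualsMax single-cover packing (≡.trans (cost-point c m) (≡.sym value))
    by-pair : c a + c b ≤ c m → ∃[ t ] MinEqualsMax E c t
    by-pair ca+cb≤cm with packing-of (c a + c b) ≤-refl ca+cb≤cm
    ... | y , packing , value = equal-values⇒minEqualsMax pair-cover packing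
      (≡.trans (cost-+ c (point a 1) (point b 1)) (≡.trans (cong₂ _+_ (cost-point c a) (cost-point c b)) (≡.sym value)))

  ¬mengerian-three : {a b d : Fin n} → a ≢ b → a ≢ d → b ≢ d → F a → F b → F d → ¬ Mengerian E
  ¬mengerian-three {a} {b} {d} a≢b a≢d b≢d Fa Fb Fd mengerian = impossible (mengerian c)
    where
    z : Fin n → ℕ
    z v = point a 1 v + (point b 1 v + point d 1 v)
    c : Fin n → ℕ
    c v = 2 ∸ z v
    z-outside : ∀ {v} → v ≢ a → v ≢ b → v ≢ d → z v ≡ 0
    z-outside v≢a v≢b v≢d = cong₂ _+_ (point-other 1 v≢a) (cong₂ _+_ (point-other 1 v≢b) (point-other 1 v≢d))
    z≤1 : ∀ v → z v ≤ 1
    z≤1 v = at-most-one v (v ≟ a) (v ≟ b) (v ≟ d)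
      where
      at-most-one : ∀ v → Dec (v ≡ a) → Dec (v ≡ b) → Dec (v ≡ d) → z v ≤ 1
      at-most-one v (yes refl) _ _ =
        ≤-reflexive (cong₂ _+_ (point-self a 1) (cong₂ _+_ (point-other 1 a≢b) (point-other 1 a≢d)))
      at-most-one v (no v≢a) (yes refl) _ =
        ≤-reflexive (cong₂ _+_ (point-other 1 v≢a) (cong₂ _+_ (point-self b 1) (point-other 1 b≢d)))
      at-most-one v (no v≢a) (no v≢b) (yes refl) =
        ≤-reflexive (cong₂ _+_ (point-other 1 v≢a) (cong₂ _+_ (point-other 1 v≢b) (point-self d 1)))
      at-most-one v (no v≢a) (no v≢b) (no v≢d) = subst (_≤ 1) (≡.sym (z-outside v≢a v≢b v≢d)) z≤n
    ∑z≡3 : ∑ z ≡ 3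
    ∑z≡3 = ≡.trans (∑-+ (point a 1) (λ v → point b 1 v + point d 1 v))
             (cong₂ _+_ (∑-point a 1) (≡.trans (∑-+ (point b 1) (point d 1)) (cong₂ _+_ (∑-point b 1) (∑-point d 1))))
    weight-z : ∀ w → weight z (∁ ⁅ w ⁆) ≡ 3 ∸ z w
    weight-z w = ≡.trans (≡.sym (m+n∸n≡m _ (z w))) (cong (_∸ z w) (≡.trans (weight-∁⁅⁆ z w) ∑z≡3))
    two-cover : ∀ S → E S → 2 ≤ weight z S
    two-cover S ES with edges S ES
    ... | w , refl = subst (2 ≤_) (≡.sym (weight-z w)) (∸-monoʳ-≤ 3 (z≤1 w))
    cost-z : cost c z ≡ 3
    cost-z = ≡.trans (∑-cong λ v → 2∸t*t≡t (z≤1 v)) ∑z≡3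
      where
      2∸t*t≡t : ∀ {t} → t ≤ 1 → (2 ∸ t) * t ≡ t
      2∸t*t≡t z≤n       = refl
      2∸t*t≡t (s≤s z≤n) = refl
    c₂ : Fin n → ℕ
    c₂ v = 2 * c v
    z-packing : IsPacking E c₂ (spread z)
    z-packing = spread-packing support load-bound
      where
      support : ∀ v → ¬ F v → z v ≡ 0
      support v ¬Fv = z-outside (λ v≡a → ¬Fv (subst F (≡.sym v≡a) Fa)) (λ v≡b → ¬Fv (subst F (≡.sym v≡b) Fb))
                                (λ v≡d → ¬Fv (subst F (≡.sym v≡d) Fd))
      3∸t≤2*[2∸t] : ∀ {t} → t ≤ 1 → 3 ∸ t ≤ 2 * (2 ∸ t)
      3∸t≤2*[2∸t] z≤n       = s≤s (s≤s (s≤s z≤n))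
      3∸t≤2*[2∸t] (s≤s z≤n) = ≤-refl
      load-bound : ∀ w → weight z (∁ ⁅ w ⁆) ≤ c₂ w
      load-bound w = subst (_≤ c₂ w) (≡.sym (weight-z w)) (3∸t≤2*[2∸t] (z≤1 w))
    impossible : ∃[ m ] MinEqualsMax E c m → ⊥
    impossible (m , ((x , x-cover , x-cost) , _) , ((y , y-packing , y-value) , _)) =
      k*2≢3 m (≡.trans (*-comm m 2) (≤-antisym upper lower))
      where
      upper : 2 * m ≤ 3
      upper = subst₂ (λ s t → 2 * s ≤ t) y-value cost-z (weak-duality y-packing two-cover)
      cost-c₂ : cost c₂ x ≡ 2 * m
      cost-c₂ = ≡.trans (∑-cong λ v → *-assoc 2 (c v) (x v))
                        (≡.trans (∑-*ˡ 2 (λ v → c v * x v)) (cong (2 *_) x-cost))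
      lower : 3 ≤ 2 * m
      lower = subst₂ _≤_ (≡.trans (∑Sub-spread z) ∑z≡3) cost-c₂ (packing≤cover z-packing x-cover)
      k*2≢3 : ∀ k → k * 2 ≢ 3
      k*2≢3 zero          ()
      k*2≢3 (suc zero)    ()
      k*2≢3 (suc (suc k)) ()

WithinTwo : (Fin n → Set) → Set
WithinTwo P = ∃[ a ] ∃[ b ] ∀ v → P v → v ≡ a ⊎ v ≡ b

noThree⇒withinTwo : {P : Fin (suc n) → Set} → U.Decidable P →
                    (∀ {a b d} → a ≢ b → a ≢ d → b ≢ d → P a → P b → P d → ⊥) → WithinTwo P
noThree⇒withinTwo {P = P} P? noThree with any? P?
... | no ∄a = zero , zero , λ v Pv → ⊥-elim (∄a (v , Pv))
... | yes (a , Pa) with any? (λ b → ¬? (b ≟ a) ×-dec P? b)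
...   | no ∄b = a , a , λ v Pv → inj₁ (decidable-stable (v ≟ a) λ v≢a → ∄b (v , v≢a , Pv))
...   | yes (b , b≢a , Pb) = a , b , λ v Pv → a-or-b v Pv (v ≟ a) (v ≟ b)
  where
  a-or-b : ∀ v → P v → Dec (v ≡ a) → Dec (v ≡ b) → v ≡ a ⊎ v ≡ b
  a-or-b v Pv (yes v≡a) _         = inj₁ v≡a
  a-or-b v Pv (no _)    (yes v≡b) = inj₂ v≡b
  a-or-b v Pv (no v≢a)  (no v≢b)  = ⊥-elim (noThree (b≢a ∘ ≡.sym) (v≢a ∘ ≡.sym) (v≢b ∘ ≡.sym) Pa Pb Pv)

thirdVertex : ∀ {m} (a b : Fin (3 + m)) → ∃[ u ] (u ≢ a × u ≢ b)
thirdVertex zero          zero          = suc zero , (λ ()) , (λ ())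
thirdVertex zero          (suc zero)    = suc (suc zero) , (λ ()) , (λ ())
thirdVertex zero          (suc (suc _)) = suc zero , (λ ()) , (λ ())
thirdVertex (suc zero)    zero          = suc (suc zero) , (λ ()) , (λ ())
thirdVertex (suc zero)    (suc _)       = zero , (λ ()) , (λ ())
thirdVertex (suc (suc _)) zero          = suc zero , (λ ()) , (λ ())
thirdVertex (suc (suc _)) (suc _)       = zero , (λ ()) , (λ ())

coSingletons-mengerian⇔ : ∀ {m} {E : Subset (3 + m) → Set} → CoSingletonEdges E →
                          U.Decidable (λ v → E (∁ ⁅ v ⁆)) → Mengerian E ⇔ WithinTwo (λ v → E (∁ ⁅ v ⁆))
coSingletons-mengerian⇔ {E = E} edges F? = mk⇔ to from
  where
  F = λ v → E (∁ ⁅ v ⁆)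
  to : Mengerian E → WithinTwo F
  to mengerian = noThree⇒withinTwo F? λ a≢b a≢d b≢d Fa Fb Fd →
    ¬mengerian-three edges a≢b a≢d b≢d Fa Fb Fd mengerian
  first : ∀ {a b} → (∀ v → F v → v ≡ a ⊎ v ≡ b) → ¬ F b → ∀ v → F v → v ≡ a
  first only ¬Fb v Fv = [ id , (λ v≡b → ⊥-elim (¬Fb (subst F v≡b Fv))) ]′ (only v Fv)
  from : WithinTwo F → Mengerian E
  from (a , b , only) with thirdVertex a b | F? a | F? b
  ... | _ , u≢a , u≢b | no ¬Fa | no ¬Fb = mengerian-none edges λ v Fv → ¬Fa (subst F (first only ¬Fb v Fv) Fv)
  ... | _ , u≢a , u≢b | yes Fa | no ¬Fb = mengerian-one edges (first only ¬Fb) Fa u≢a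
  ... | _ , u≢a , u≢b | no ¬Fa | yes Fb = mengerian-one edges (first (λ v Fv → swap (only v Fv)) ¬Fa) Fb u≢b
  ... | _ , u≢a , u≢b | yes Fa | yes Fb with a ≟ b
  ...   | yes refl = mengerian-one edges (λ v Fv → [ id , id ]′ (only v Fv)) Fa u≢a
  ...   | no  a≢b  = mengerian-two edges only a≢b Fa Fb u≢a u≢b

-- Boolean decision procedures

map-reflects : A ⇔ B → Reflects A b → Reflects B b
map-reflects A⇔B (ofʸ  x) = ofʸ (Equivalence.to A⇔B x)
map-reflects A⇔B (ofⁿ ¬x) = ofⁿ (¬x ∘ Equivalence.from A⇔B)

⇔-reflects : Reflects A a → Reflects B b → Reflects (A ⇔ B) (not (a xor b))
⇔-reflects (ofʸ  x) (ofʸ  y) = ofʸ (mk⇔ (λ _ → y) (λ _ → x))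
⇔-reflects (ofʸ  x) (ofⁿ ¬y) = ofⁿ λ x⇔y → ¬y (Equivalence.to x⇔y x)
⇔-reflects (ofⁿ ¬x) (ofʸ  y) = ofⁿ λ x⇔y → ¬x (Equivalence.from x⇔y y)
⇔-reflects (ofⁿ ¬x) (ofⁿ ¬y) = ofʸ (mk⇔ (⊥-elim ∘ ¬x) (⊥-elim ∘ ¬y))

_⇔-dec_ : Dec A → Dec B → Dec (A ⇔ B)
a? ⇔-dec b? = not (does a? xor does b?) because ⇔-reflects (proof a?) (proof b?)

anyᵇ : (Fin n → Bool) → Bool
anyᵇ {zero}  p = false
anyᵇ {suc n} p = p zero ∨ anyᵇ (p ∘ suc)

allᵇ : (Fin n → Bool) → Bool
allᵇ {zero}  p = true
allᵇ {suc n} p = p zero ∧ allᵇ (p ∘ suc)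

any-reflects : {P : Fin n → Set} {p : Fin n → Bool} → (∀ i → Reflects (P i) (p i)) →
               Reflects (∃[ i ] P i) (anyᵇ p)
any-reflects {zero}  r = ofⁿ λ ()
any-reflects {suc n} r = map-reflects ⊎⇔∃ (r zero ⊎-reflects any-reflects (r ∘ suc))

all-reflects : {P : Fin n → Set} {p : Fin n → Bool} → (∀ i → Reflects (P i) (p i)) →
               Reflects (∀ i → P i) (allᵇ p)
all-reflects {zero}  r = ofʸ λ ()
all-reflects {suc n} r = map-reflects ∀-cons-⇔ (r zero ×-reflects all-reflects (r ∘ suc))

allᵛ : (A → Bool) → Vec A m → Bool
allᵛ p []       = true
allᵛ p (x ∷ xs) = p x ∧ allᵛ p xs

allᵛ-reflects : {P : A → Set} {p : A → Bool} → (∀ x → Reflects (P x) (p x)) →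
                (xs : Vec A m) → Reflects (All P xs) (allᵛ p xs)
allᵛ-reflects r []       = ofʸ []
allᵛ-reflects r (x ∷ xs) = map-reflects (mk⇔ (uncurry _∷_) All.uncons) (r x ×-reflects allᵛ-reflects r xs)

tabulate-reflects : {P : Fin n → Set} {p : Fin n → Bool} → (∀ i → Reflects (P i) (p i)) →
                    ∀ i → Reflects (P i) (lookup (tabulate p) i)
tabulate-reflects {P = P} {p} r i = subst (Reflects (P i)) (≡.sym (lookup∘tabulate p i)) (r i)

-- Agda's evaluator does not share repeated subterms, so a vector of costly booleans that k
-- consults many times is evaluated entry by entry once and handed to k as constructors.
withEvaluated : Vec Bool n → (Vec Bool n → A) → A
withEvaluated []       k = k []
withEvaluated (b ∷ bs) k = if b then withEvaluated bs (k ∘ (true ∷_)) else withEvaluated bs (k ∘ (false ∷_))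

withEvaluated-reflects : {P : Set} (bs : Vec Bool n) (k : Vec Bool n → Bool) →
                         Reflects P (k bs) → Reflects P (withEvaluated bs k)
withEvaluated-reflects []           k r = r
withEvaluated-reflects (true  ∷ bs) k r = withEvaluated-reflects bs (k ∘ (true ∷_)) r
withEvaluated-reflects (false ∷ bs) k r = withEvaluated-reflects bs (k ∘ (false ∷_)) r

withEvaluated-dec : {P : Set} (bs : Vec Bool n) (k : Vec Bool n → Bool) → Reflects P (k bs) → Dec P
withEvaluated-dec bs k r = withEvaluated bs k because withEvaluated-reflects bs k r

_==_ : Fin n → Fin n → Bool
u == v = does (u ≟ v)

==-reflects : (u v : Fin n) → Reflects (u ≡ v) (u == v)
==-reflects u v = proof (u ≟ v)

≡true-reflects : ∀ b → Reflects (b ≡ true) b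
≡true-reflects b = map-reflects T-≡ (T-reflects b)

adj-reflects : (G : Graph n) (u v : Fin n) → Reflects (Adj G u v) (adj G u v)
adj-reflects G u v = ≡true-reflects (adj G u v)

∈-reflects : (v : Fin n) (S : Subset n) → Reflects (v ∈ S) (lookup S v)
∈-reflects v S = map-reflects (mk⇔ (lookup⇒[]= v S) []=⇒lookup) (≡true-reflects (lookup S v))

withinTwoᵇ : (Fin n → Bool) → Bool
withinTwoᵇ p = anyᵇ λ a → anyᵇ λ b → allᵇ λ v → not (p v) ∨ (v == a ∨ v == b)

withinTwo-reflects : {P : Fin n → Set} {p : Fin n → Bool} → (∀ v → Reflects (P v) (p v)) →
                     Reflects (WithinTwo P) (withinTwoᵇ p)
withinTwo-reflects r = any-reflects λ a → any-reflects λ b → all-reflects λ v →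
  r v →-reflects (==-reflects v a ⊎-reflects ==-reflects v b)

IsPath : Graph n → Vec (Fin n) m → Set
IsPath G vs = Unique vs × Linked (Adj G) vs

-- Paths through vertices satisfying q are grown one vertex at a time, so that adjacency, q and
-- distinctness prune the search as early as possible.
pathsᵇ : Graph n → (Fin n → Bool) → (m : ℕ) → (Vec (Fin n) (suc m) → Bool) → Bool
pathsᵇ G q zero    p = anyᵇ λ x → q x ∧ p (x ∷ [])
pathsᵇ G q (suc m) p = pathsᵇ G q m λ ws →
  anyᵇ λ x → adj G x (head ws) ∧ q x ∧ allᵛ (λ w → not (x == w)) ws ∧ p (x ∷ ws)

paths-reflects : (G : Graph n) {Q : Fin n → Set} {q : Fin n → Bool} → (∀ x → Reflects (Q x) (q x)) →
                 (m : ℕ) {P : Vec (Fin n) (suc m) → Set} {p : Vec (Fin n) (suc m) → Bool} →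
                 (∀ vs → Reflects (P vs) (p vs)) → Reflects (∃[ vs ] (IsPath G vs × All Q vs × P vs)) (pathsᵇ G q m p)
paths-reflects G rq zero r =
  map-reflects (mk⇔ (λ (x , Qx , Px) → x ∷ [] , ([] ∷ [] , [-]) , Qx ∷ [] , Px)
                    (λ { (x ∷ [] , _ , Qx ∷ [] , Px) → x , Qx , Px }))
               (any-reflects λ x → rq x ×-reflects r (x ∷ []))
paths-reflects {n} G {Q} rq (suc m) {P} r = map-reflects (mk⇔ extend restrict)
  (paths-reflects G rq m λ ws → any-reflects λ x → adj-reflects G x (head ws) ×-reflects rq x ×-reflects
     allᵛ-reflects (λ w → ¬-reflects (==-reflects x w)) ws ×-reflects r (x ∷ ws))
  where
  Extension : Vec (Fin n) (suc m) → Set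
  Extension ws = ∃[ x ] (Adj G x (head ws) × Q x × All (x ≢_) ws × P (x ∷ ws))
  extend : ∃[ ws ] (IsPath G ws × All Q ws × Extension ws) → ∃[ vs ] (IsPath G vs × All Q vs × P vs)
  extend (ws , (distinct , linked) , Qws , x , x~w , Qx , x∉ws , Pxws) =
    x ∷ ws , (x∉ws ∷ distinct , x~w ∷ linked) , Qx ∷ Qws , Pxws
  restrict : ∃[ vs ] (IsPath G vs × All Q vs × P vs) → ∃[ ws ] (IsPath G ws × All Q ws × Extension ws)
  restrict (x ∷ ws , (x∉ws ∷ distinct , x~w ∷ linked) , Qx ∷ Qws , Pxws) =
    ws , (distinct , linked) , Qws , x , x~w , Qx , x∉ws , Pxws

∣S∣≡n⇒coSingleton : (S : Subset (suc n)) → ∣ S ∣ ≡ n → ∃[ v ] S ≡ ∁ ⁅ v ⁆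
∣S∣≡n⇒coSingleton {n} (outside ∷ S) ∣S∣≡n =
  zero , cong (outside ∷_) (≡.trans (∣p∣≡n⇒p≡⊤ ∣S∣≡n) (≡.sym (map-replicate not outside n)))
∣S∣≡n⇒coSingleton {suc n} (inside ∷ S) ∣S∣≡n with ∣S∣≡n⇒coSingleton S (suc-injective ∣S∣≡n)
... | v , refl = suc v , refl

H₃-coSingletonEdges : (G : Graph 5) → CoSingletonEdges (H₃ G)
H₃-coSingletonEdges G S (∣S∣≡4 , _) = ∣S∣≡n⇒coSingleton S ∣S∣≡4

H₃⇔path : (G : Graph n) (S : Subset n) →
          H₃ G S ⇔ (∣ S ∣ ≡ 4 × Σ[ vs ∈ Vec (Fin n) 4 ] (IsPath G vs × All (_∈ S) vs))
H₃⇔path {n} G S = mk⇔ to from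
  where
  to : H₃ G S → ∣ S ∣ ≡ 4 × Σ[ vs ∈ Vec (Fin n) 4 ] (IsPath G vs × All (_∈ S) vs)
  to (∣S∣≡4 , v₁ , v₂ , v₃ , v₄ , (m₁ , m₂ , m₃ , m₄) , (d₁₂ , d₁₃ , d₁₄ , d₂₃ , d₂₄ , d₃₄) , (a₁₂ , a₂₃ , a₃₄)) =
    ∣S∣≡4 , v₁ ∷ v₂ ∷ v₃ ∷ v₄ ∷ [] ,
    ((d₁₂ ∷ d₁₃ ∷ d₁₄ ∷ []) ∷ (d₂₃ ∷ d₂₄ ∷ []) ∷ (d₃₄ ∷ []) ∷ [] ∷ [] , a₁₂ ∷ a₂₃ ∷ a₃₄ ∷ [-]) ,
    m₁ ∷ m₂ ∷ m₃ ∷ m₄ ∷ []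
  from : ∣ S ∣ ≡ 4 × Σ[ vs ∈ Vec (Fin n) 4 ] (IsPath G vs × All (_∈ S) vs) → H₃ G S
  from (∣S∣≡4 , v₁ ∷ v₂ ∷ v₃ ∷ v₄ ∷ [] ,
        ((d₁₂ ∷ d₁₃ ∷ d₁₄ ∷ []) ∷ (d₂₃ ∷ d₂₄ ∷ []) ∷ (d₃₄ ∷ []) ∷ [] ∷ [] , a₁₂ ∷ a₂₃ ∷ a₃₄ ∷ [-]) ,
        m₁ ∷ m₂ ∷ m₃ ∷ m₄ ∷ []) =
    ∣S∣≡4 , v₁ , v₂ , v₃ , v₄ , (m₁ , m₂ , m₃ , m₄) , (d₁₂ , d₁₃ , d₁₄ , d₂₃ , d₂₄ , d₃₄) , (a₁₂ , a₂₃ , a₃₄)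

Deletable : Graph n → Fin n → Set
Deletable G v = H₃ G (∁ ⁅ v ⁆)

∣∁⁅⁆∣ : (v : Fin (suc n)) → ∣ ∁ ⁅ v ⁆ ∣ ≡ n
∣∁⁅⁆∣ {n} v = ≡.trans (∣∁p∣≡n∸∣p∣ ⁅ v ⁆) (cong (suc n ∸_) (∣⁅x⁆∣≡1 v))

deletableᵇ : Graph n → Fin n → Bool
deletableᵇ G v = pathsᵇ G (lookup (∁ ⁅ v ⁆)) 3 (λ _ → true)

deletable-reflects : (G : Graph 5) (v : Fin 5) → Reflects (Deletable G v) (deletableᵇ G v)
deletable-reflects G v = map-reflects (mk⇔ to-edge from-edge)
  (paths-reflects G (λ x → ∈-reflects x (∁ ⁅ v ⁆)) 3 λ _ → ofʸ tt)
  where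
  to-edge = λ (vs , path , avoids-v , _) → Equivalence.from (H₃⇔path G _) (∣∁⁅⁆∣ v , vs , path , avoids-v)
  from-edge = λ edge → let (_ , vs , path , avoids-v) = Equivalence.to (H₃⇔path G _) edge in vs , path , avoids-v , tt

deletable? : (G : Graph 5) → U.Decidable (Deletable G)
deletable? G v = deletableᵇ G v because deletable-reflects G v

Linked⇒lookup : {R : A → A → Set} {xs : Vec A (suc m)} → Linked R xs →
                ∀ i → R (lookup xs (inject₁ i)) (lookup xs (suc i))
Linked⇒lookup {xs = x ∷ y ∷ xs} (x~y ∷ _)      zero    = x~y
Linked⇒lookup {xs = x ∷ y ∷ xs} (_   ∷ linked) (suc i) = Linked⇒lookup linked i

lookup⇒Linked : {R : A → A → Set} {xs : Vec A (suc m)} →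
                (∀ i → R (lookup xs (inject₁ i)) (lookup xs (suc i))) → Linked R xs
lookup⇒Linked {xs = x ∷ []}     _      = [-]
lookup⇒Linked {xs = x ∷ y ∷ xs} linked = linked zero ∷ lookup⇒Linked (linked ∘ suc)

Cycle : Graph n → ℕ → Set
Cycle {n} G k = Σ[ vs ∈ Vec (Fin n) (3 + k) ] (IsPath G vs × Adj G (lookup vs (fromℕ (2 + k))) (lookup vs zero))

HasCycle⇔Cycle : (G : Graph n) → HasCycle G ⇔ (∃[ k ] Cycle G k)
HasCycle⇔Cycle G = mk⇔ to from
  where
  to : HasCycle G → ∃[ k ] Cycle G k
  to (k , f , injective , steps , closing) =
    k , tabulate f , (tabulate⁺ (injective _ _) , lookup⇒Linked (λ i → tabulated (steps i))) , tabulated closing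
    where
    tabulated : ∀ {i j} → Adj G (f i) (f j) → Adj G (lookup (tabulate f) i) (lookup (tabulate f) j)
    tabulated = subst₂ (Adj G) (≡.sym (lookup∘tabulate f _)) (≡.sym (lookup∘tabulate f _))
  from : ∃[ k ] Cycle G k → HasCycle G
  from (k , vs , (distinct , linked) , closing) =
    k , lookup vs , lookup-injective distinct , Linked⇒lookup linked , closing

Cycle-bound : (G : Graph n) {k : ℕ} → Cycle G k → k < n ∸ 2
Cycle-bound G (vs , (distinct , _) , _) = ∸-monoˡ-≤ 2 (injective⇒≤ (lookup-injective distinct _ _))

hasCycleᵇ : Graph n → Bool
hasCycleᵇ {n} G = anyᵇ λ (k : Fin (n ∸ 2)) →
  pathsᵇ G (λ _ → true) (2 + toℕ k) λ vs → adj G (lookup vs (fromℕ (2 + toℕ k))) (lookup vs zero)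

hasCycle-reflects : (G : Graph n) → Reflects (HasCycle G) (hasCycleᵇ G)
hasCycle-reflects {n} G = map-reflects (mk⇔ from-bounded to-bounded)
  (any-reflects λ k → paths-reflects G (λ _ → ofʸ tt) (2 + toℕ k) λ vs → adj-reflects G _ _)
  where
  CycleWithin : Fin (n ∸ 2) → Set
  CycleWithin k = ∃[ vs ] (IsPath G vs × All (λ _ → ⊤) vs × Adj G (lookup vs (fromℕ (2 + toℕ k))) (lookup vs zero))
  from-bounded : ∃[ k ] CycleWithin k → HasCycle G
  from-bounded (k , vs , path , _ , closing) = Equivalence.from (HasCycle⇔Cycle G) (toℕ k , vs , path , closing)
  to-bounded : HasCycle G → ∃[ k ] CycleWithin k
  to-bounded cycle with Equivalence.to (HasCycle⇔Cycle G) cycle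
  ... | k , C with subst (Cycle G) (≡.sym (toℕ-fromℕ< (Cycle-bound G C))) C
  ...   | vs , path , closing = fromℕ< (Cycle-bound G C) , vs , path , All.universal (λ _ → tt) vs , closing

hasCycle? : (G : Graph n) → Dec (HasCycle G)
hasCycle? G = hasCycleᵇ G because hasCycle-reflects G

IsSupportVertex : Graph n → Fin n → Set
IsSupportVertex G v = ∃[ ℓ ] (IsLeaf G ℓ × Adj G v ℓ)

supportVertexᵇ : Graph n → Fin n → Bool
supportVertexᵇ G v = anyᵇ λ ℓ → does (degree G ℓ ℕ.≟ 1) ∧ adj G v ℓ

supportVertex-reflects : (G : Graph n) (v : Fin n) → Reflects (IsSupportVertex G v) (supportVertexᵇ G v)
supportVertex-reflects G v = any-reflects λ ℓ → proof (degree G ℓ ℕ.≟ 1) ×-reflects adj-reflects G v ℓ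

StarPlusEdgeAdj : (c x y u v : Fin n) → Set
StarPlusEdgeAdj c x y u v = (u ≡ c × v ≢ c) ⊎ (v ≡ c × u ≢ c) ⊎ (u ≡ x × v ≡ y) ⊎ (u ≡ y × v ≡ x)

starPlusEdgeAdjᵇ : (c x y u v : Fin n) → Bool
starPlusEdgeAdjᵇ c x y u v =
  (u == c ∧ not (v == c)) ∨ (v == c ∧ not (u == c)) ∨ (u == x ∧ v == y) ∨ (u == y ∧ v == x)

starPlusEdgeAdj-reflects : (c x y u v : Fin n) → Reflects (StarPlusEdgeAdj c x y u v) (starPlusEdgeAdjᵇ c x y u v)
starPlusEdgeAdj-reflects c x y u v =
  (==-reflects u c ×-reflects ¬-reflects (==-reflects v c)) ⊎-reflects
  (==-reflects v c ×-reflects ¬-reflects (==-reflects u c)) ⊎-reflects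
  (==-reflects u x ×-reflects ==-reflects v y) ⊎-reflects (==-reflects u y ×-reflects ==-reflects v x)

-- The centre is adjacent to every other vertex and x to y; testing this first cuts the search short.
starPlusEdgeᵇ : Graph n → Bool
starPlusEdgeᵇ G = anyᵇ λ c → allᵇ (λ v → v == c ∨ adj G c v) ∧ anyᵇ λ x → anyᵇ λ y →
  adj G x y ∧ not (x == c) ∧ not (y == c) ∧ not (x == y) ∧
  allᵇ λ u → allᵇ λ v → not (adj G u v xor starPlusEdgeAdjᵇ c x y u v)

starPlusEdge-reflects : (G : Graph n) → Reflects (StarPlusEdge G) (starPlusEdgeᵇ G)
starPlusEdge-reflects {n} G = any-reflects λ c → map-reflects (mk⇔ forget (remember c))
  (all-reflects (λ v → ==-reflects v c ⊎-reflects adj-reflects G c v) ×-reflects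
   any-reflects λ x → any-reflects λ y → adj-reflects G x y ×-reflects
     ¬-reflects (==-reflects x c) ×-reflects ¬-reflects (==-reflects y c) ×-reflects ¬-reflects (==-reflects x y) ×-reflects
     all-reflects λ u → all-reflects λ v → ⇔-reflects (adj-reflects G u v) (starPlusEdgeAdj-reflects c x y u v))
  where
  StarAround : Fin n → Fin n → Fin n → Set
  StarAround c x y = x ≢ c × y ≢ c × x ≢ y × ∀ u v → Adj G u v ⇔ StarPlusEdgeAdj c x y u v
  Tested : Fin n → Set
  Tested c = (∀ v → v ≡ c ⊎ Adj G c v) × (∃[ x ] ∃[ y ] (Adj G x y × StarAround c x y))
  forget : ∀ {c} → Tested c → ∃[ x ] ∃[ y ] StarAround c x y
  forget (_ , x , y , _ , star) = x , y , star
  remember : ∀ c → ∃[ x ] ∃[ y ] StarAround c x y → Tested c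
  remember c (x , y , star@(_ , _ , _ , adj⇔)) =
    (λ v → centre v (v ≟ c)) , x , y , Equivalence.from (adj⇔ x y) (inj₂ (inj₂ (inj₁ (refl , refl)))) , star
    where
    centre : ∀ v → Dec (v ≡ c) → v ≡ c ⊎ Adj G c v
    centre v (yes v≡c) = inj₁ v≡c
    centre v (no  v≢c) = inj₂ (Equivalence.from (adj⇔ c v) (inj₁ (refl , v≢c)))

starPlusEdge? : (G : Graph n) → Dec (StarPlusEdge G)
starPlusEdge? G = starPlusEdgeᵇ G because starPlusEdge-reflects G

Closed : Graph n → Subset n → Set
Closed G S = ∀ {u v} → u ∈ S → Adj G u v → v ∈ S

walk-closed : {G : Graph n} {S : Subset n} → Closed G S → ∀ {u v} → Walk G u v → u ∈ S → v ∈ S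
walk-closed closed here           u∈S = u∈S
walk-closed closed (step u~w w⇝v) u∈S = walk-closed closed w⇝v (closed u∈S u~w)

closedᵇ : Graph n → Subset n → Bool
closedᵇ G S = allᵇ λ u → allᵇ λ v → not (lookup S u ∧ adj G u v) ∨ lookup S v

closed-reflects : (G : Graph n) (S : Subset n) → Reflects (Closed G S) (closedᵇ G S)
closed-reflects G S =
  map-reflects (mk⇔ (λ closed {u} {v} u∈S u~v → closed u v (u∈S , u~v)) (λ closed u v (u∈S , u~v) → closed u∈S u~v))
    (all-reflects λ u → all-reflects λ v → (∈-reflects u S ×-reflects adj-reflects G u v) →-reflects ∈-reflects v S)

expand : Graph n → Subset n → Subset n
expand G S = tabulate λ v → lookup S v ∨ anyᵇ λ u → lookup S u ∧ adj G u v

ball : Graph n → ℕ → Subset n → Subset n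
ball G zero    S = S
ball G (suc k) S = ball G k (expand G S)

FullIfClosed : Graph (suc n) → Subset (suc n) → Set
FullIfClosed G S = zero ∈ S → Closed G S → ∀ v → v ∈ S

connected⇒fullIfClosed : {G : Graph (suc n)} {S : Subset (suc n)} → Connected G → FullIfClosed G S
connected⇒fullIfClosed connected zero∈S closed v = walk-closed closed (connected zero v) zero∈S

fullIfClosedᵇ : Graph (suc n) → Subset (suc n) → Bool
fullIfClosedᵇ G S = not (lookup S zero) ∨ (not (closedᵇ G S) ∨ allᵇ (lookup S))

fullIfClosed-reflects : (G : Graph (suc n)) (S : Subset (suc n)) → Reflects (FullIfClosed G S) (fullIfClosedᵇ G S)
fullIfClosed-reflects G S =
  ∈-reflects zero S →-reflects (closed-reflects G S →-reflects all-reflects λ v → ∈-reflects v S)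

AcyclicWithTwoSupports : Graph n → Set
AcyclicWithTwoSupports G = Acyclic G × WithinTwo (IsSupportVertex G)

pathWithDoubleStars⇔ : {G : Graph n} → Connected G → PathWithDoubleStars G ⇔ AcyclicWithTwoSupports G
pathWithDoubleStars⇔ connected =
  mk⇔ (λ ((_ , acyclic) , supports) → acyclic , supports) (λ (acyclic , supports) → (connected , acyclic) , supports)

record _≈_ (G H : Graph n) : Set where
  constructor same-adj
  field adj-≡ : ∀ u v → adj G u v ≡ adj H u v

≈-sym : {G H : Graph n} → G ≈ H → H ≈ G
≈-sym (same-adj G≗H) = same-adj λ u v → ≡.sym (G≗H u v)

Adj-≈ : {G H : Graph n} → G ≈ H → ∀ {u v} → Adj G u v → Adj H u v
Adj-≈ (same-adj G≗H) {u} {v} u~v = ≡.trans (≡.sym (G≗H u v)) u~v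

Connected-≈ : {G H : Graph n} → G ≈ H → Connected G → Connected H
Connected-≈ {G = G} {H} G≈H connected u v = walk (connected u v)
  where
  walk : ∀ {u v} → Walk G u v → Walk H u v
  walk here           = here
  walk (step u~w w⇝v) = step (Adj-≈ G≈H u~w) (walk w⇝v)

HasCycle-≈ : {G H : Graph n} → G ≈ H → HasCycle G → HasCycle H
HasCycle-≈ G≈H (k , f , injective , steps , closing) =
  k , f , injective , (λ i → Adj-≈ G≈H {f (inject₁ i)} {f (suc i)} (steps i)) ,
  Adj-≈ G≈H {f (fromℕ (2 + k))} {f zero} closing

H₃-≈ : {G H : Graph n} → G ≈ H → H₃ G ⊆ H₃ H
H₃-≈ G≈H (∣S∣≡4 , v₁ , v₂ , v₃ , v₄ , members , distinct , (a₁₂ , a₂₃ , a₃₄)) =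
  ∣S∣≡4 , v₁ , v₂ , v₃ , v₄ , members , distinct ,
  (Adj-≈ G≈H {v₁} {v₂} a₁₂ , Adj-≈ G≈H {v₂} {v₃} a₂₃ , Adj-≈ G≈H {v₃} {v₄} a₃₄)

WithinTwo-map : {P Q : Fin n → Set} → Q ⊆ P → WithinTwo P → WithinTwo Q
WithinTwo-map Q⊆P (a , b , only) = a , b , λ v → only v ∘ Q⊆P

withinTwoDeletable-≈ : {G H : Graph n} → G ≈ H → WithinTwo (Deletable G) ⇔ WithinTwo (Deletable H)
withinTwoDeletable-≈ G≈H = mk⇔ (WithinTwo-map (H₃-≈ (≈-sym G≈H))) (WithinTwo-map (H₃-≈ G≈H))

IsSupportVertex-≈ : {G H : Graph n} → G ≈ H → IsSupportVertex G ⊆ IsSupportVertex H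
IsSupportVertex-≈ G≈H@(same-adj G≗H) (ℓ , leaf , v~ℓ) =
  ℓ , ≡.trans (≡.sym (∑-cong λ u → cong (λ b → if b then 1 else 0) (G≗H ℓ u))) leaf , Adj-≈ G≈H v~ℓ

AcyclicWithTwoSupports-≈ : {G H : Graph n} → G ≈ H → AcyclicWithTwoSupports G → AcyclicWithTwoSupports H
AcyclicWithTwoSupports-≈ G≈H (acyclic , supports) =
  acyclic ∘ HasCycle-≈ (≈-sym G≈H) , WithinTwo-map (IsSupportVertex-≈ (≈-sym G≈H)) supports

StarPlusEdge-≈ : {G H : Graph n} → G ≈ H → StarPlusEdge G → StarPlusEdge H
StarPlusEdge-≈ G≈H (c , x , y , x≢c , y≢c , x≢y , adj⇔) =
  c , x , y , x≢c , y≢c , x≢y , λ u v → adj⇔ u v ⇔-∘ mk⇔ (Adj-≈ (≈-sym G≈H)) (Adj-≈ G≈H)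

-- Graphs on five vertices

-- A graph on suc n vertices is coded by the neighbourhood of zero and the graph on the other vertices.
GraphCode : ℕ → Set
GraphCode zero    = ⊤
GraphCode (suc n) = Subset n × GraphCode n

adjOf : GraphCode n → Fin n → Fin n → Bool
adjOf {suc n} (N , b) zero    zero    = false
adjOf {suc n} (N , b) zero    (suc v) = lookup N v
adjOf {suc n} (N , b) (suc u) zero    = lookup N u
adjOf {suc n} (N , b) (suc u) (suc v) = adjOf b u v

adjOf-sym : (b : GraphCode n) → ∀ u v → adjOf b u v ≡ adjOf b v u
adjOf-sym {suc n} (N , b) zero    zero    = refl
adjOf-sym {suc n} (N , b) zero    (suc v) = refl
adjOf-sym {suc n} (N , b) (suc u) zero    = refl
adjOf-sym {suc n} (N , b) (suc u) (suc v) = adjOf-sym b u v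

adjOf-irrefl : (b : GraphCode n) → ∀ v → adjOf b v v ≡ false
adjOf-irrefl {suc n} (N , b) zero    = refl
adjOf-irrefl {suc n} (N , b) (suc v) = adjOf-irrefl b v

graphOf : GraphCode n → Graph n
graphOf b = record { adj = adjOf b ; sym = adjOf-sym b ; irrefl = adjOf-irrefl b }

dropZero : Graph (suc n) → Graph n
dropZero G = record
  { adj = λ u v → adj G (suc u) (suc v) ; sym = λ u v → sym G (suc u) (suc v) ; irrefl = irrefl G ∘ suc }

code : Graph n → GraphCode n
code {zero}  G = tt
code {suc n} G = tabulate (adj G zero ∘ suc) , code (dropZero G)

adj-code : (G : Graph n) → ∀ u v → adj G u v ≡ adjOf (code G) u v
adj-code {suc n} G zero    zero    = irrefl G zero
adj-code {suc n} G zero    (suc v) = ≡.sym (lookup∘tabulate (adj G zero ∘ suc) v)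
adj-code {suc n} G (suc u) zero    = ≡.trans (sym G (suc u) zero) (≡.sym (lookup∘tabulate (adj G zero ∘ suc) u))
adj-code {suc n} G (suc u) (suc v) = adj-code (dropZero G) u v

graphOf-code : (G : Graph n) → G ≈ graphOf (code G)
graphOf-code G = same-adj (adj-code G)

all-subsets? : {P : Subset n → Set} → U.Decidable P → Dec (∀ S → P S)
all-subsets? {zero}  P? = map′ (λ P[] → λ { [] → P[] }) (λ ∀P → ∀P []) (P? [])
all-subsets? {suc n} P? = map′ (λ (Pout , Pin) → λ { (outside ∷ S) → Pout S ; (inside ∷ S) → Pin S })
                               (λ ∀P → ∀P ∘ (outside ∷_) , ∀P ∘ (inside ∷_))
                               (all-subsets? (P? ∘ (outside ∷_)) ×-dec all-subsets? (P? ∘ (inside ∷_)))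

all-codes? : {P : GraphCode n → Set} → U.Decidable P → Dec (∀ b → P b)
all-codes? {zero}  P? = map′ (λ Ptt _ → Ptt) (λ ∀P → ∀P tt) (P? tt)
all-codes? {suc n} P? = map′ (λ ∀P (N , b) → ∀P N b) (λ ∀P N b → ∀P (N , b))
                             (all-subsets? λ N → all-codes? (P? ∘ (N ,_)))

-- For a disconnected graph the ball is the component of zero, which is closed but not full,
-- so the premise singles out the connected graphs.
Classified : Graph 5 → Set
Classified G = FullIfClosed G (ball G 4 ⁅ zero ⁆) →
               WithinTwo (Deletable G) ⇔ (AcyclicWithTwoSupports G ⊎ StarPlusEdge G)

classified? : (G : Graph 5) → Dec (Classified G)
classified? G =
  withEvaluated-dec R (fullIfClosedᵇ G) (fullIfClosed-reflects G R) →-dec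
  (withEvaluated-dec (tabulate (deletableᵇ G)) (withinTwoᵇ ∘ lookup)
                     (withinTwo-reflects (tabulate-reflects (deletable-reflects G))) ⇔-dec
   ((¬? (hasCycle? G) ×-dec
     withEvaluated-dec (tabulate (supportVertexᵇ G)) (withinTwoᵇ ∘ lookup)
                       (withinTwo-reflects (tabulate-reflects (supportVertex-reflects G)))) ⊎-dec
    starPlusEdge? G))
  where
  R = ball G 4 ⁅ zero ⁆

every-code-classified : ∀ b → Classified (graphOf b)
every-code-classified = toWitness {a? = all-codes? (classified? ∘ graphOf)} tt

classification-≈ : {G H : Graph 5} → G ≈ H → Connected G → Classified H →
                   WithinTwo (Deletable G) ⇔ (PathWithDoubleStars G ⊎ StarPlusEdge G)
classification-≈ {G} {H} G≈H connected classified-H = begin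
  WithinTwo (Deletable G)
    ∼⟨ withinTwoDeletable-≈ G≈H ⟩
  WithinTwo (Deletable H)
    ∼⟨ classified-H (connected⇒fullIfClosed (Connected-≈ G≈H connected)) ⟩
  (AcyclicWithTwoSupports H ⊎ StarPlusEdge H)
    ∼⟨ mk⇔ (AcyclicWithTwoSupports-≈ H≈G) (AcyclicWithTwoSupports-≈ G≈H) ⊎-⇔ mk⇔ (StarPlusEdge-≈ H≈G) (StarPlusEdge-≈ G≈H) ⟩
  (AcyclicWithTwoSupports G ⊎ StarPlusEdge G)
    ∼⟨ ⇔-sym (pathWithDoubleStars⇔ connected) ⊎-⇔ ⇔-id _ ⟩
  (PathWithDoubleStars G ⊎ StarPlusEdge G) ∎
  where
  open EquationalReasoning
  H≈G = ≈-sym G≈H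

classification : (G : Graph 5) → Connected G → WithinTwo (Deletable G) ⇔ (PathWithDoubleStars G ⊎ StarPlusEdge G)
classification G connected = classification-≈ (graphOf-code G) connected (every-code-classified (code G))

lemma3p9 : (G : Graph 5) → Connected G →
    (Mengerian (H₃ G) ⇔ (PathWithDoubleStars G ⊎ StarPlusEdge G))
lemma3p9 G connected =
  classification G connected ⇔-∘ coSingletons-mengerian⇔ (H₃-coSingletonEdges G) (deletable? G)
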